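{- Let $G_\infty$ be the infinite hexagonal grid. For every finite set $W\subset V(G_\infty)$ there is a finite set $W'\subset V(G_\infty)$ with $|W'|=|W|$ and $|\mathcal{N}(W')|\le|\mathcal{N}(W)|$ such that, with respect to $W'$, there is no bad row in any of the three directions.
   Context: The infinite hexagonal grid $G_\infty$ is the graph formed by the vertices and edges of the tiling of the plane by regular hexagons. Every edge of $G_\infty$ is parallel to exactly one of three directions, called directions $1,2,3$. For $i\in\{1,2,3\}$, deleting all edges parallel to direction $i$ leaves a graph whose connected components (bi-infinite zigzag paths) are called the rows of direction $i$; the rows of a fixed direction are parallel and linearly ordered across the plane. For a finite set $Z\subset V(G_\infty)$, a row is white (w.r.t. $Z$) if it contains no vertex of $Z$, and gray if it contains at least one vertex of $Z$. A row of direction $i$ is bad (w.r.t. $Z$) if it is white and separates (lies strictly between) two gray rows of direction $i$. For $W\subseteq V(G_\infty)$, $\mathcal{N}(W)=\{x\notin W : x \text{ is adjacent to some } y\in W\}$. -}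

module Defs where

open import Data.Bool using (Bool; true; false)
open import Data.Fin using (Fin; zero; suc)
open import Data.Integer using (ℤ; _+_; _-_; -_; _<_; 0ℤ; 1ℤ)
open import Data.Nat as ℕ using (ℕ)
open import Data.List using (List; length)
open import Data.List.Membership.Propositional using (_∈_)
open import Data.List.Relation.Unary.Unique.Propositional using (Unique)
open import Data.Product using (Σ; ∃; _×_; _,_)
open import Data.Sum using (_⊎_)
open import Relation.Nullary using (¬_)
open import Relation.Binary.PropositionalEquality using (_≡_)
open import Function.Bundles using (_⇔_)

-- Standard "cube coordinates" of the honeycomb: the vertices are the
-- integer triples (x₁,x₂,x₃) with x₁+x₂+x₃ ∈ {0,1}; two vertices are
-- adjacent iff one is obtained from the other by adding 1 to exactly one
-- coordinate i (this is then an edge of direction i).  Each vertex has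
-- exactly three neighbours, and the graph is the hexagonal tiling graph.
--
-- We encode such a triple by (x₁ , x₂ , b) where b = false means
-- x₃ = -x₁-x₂ (sum 0) and b = true means x₃ = 1-x₁-x₂ (sum 1); this makes
-- the encoding bijective, so propositional equality is vertex equality.

Vertex : Set
Vertex = ℤ × ℤ × Bool

Direction : Set
Direction = Fin 3

coord : Direction → Vertex → ℤ
coord zero          (x , y , b)     = x
coord (suc zero)    (x , y , b)     = y
coord (suc (suc zero)) (x , y , false) = - (x + y)
coord (suc (suc zero)) (x , y , true)  = 1ℤ - (x + y)

δ : Direction → Direction → ℤ
δ zero zero = 1ℤ
δ (suc zero) (suc zero) = 1ℤ
δ (suc (suc zero)) (suc (suc zero)) = 1ℤ
δ _ _ = 0ℤ

StepDir : Direction → Vertex → Vertex → Set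
StepDir i u v = ∀ j → coord j v ≡ coord j u + δ i j

EdgeDir : Direction → Vertex → Vertex → Set
EdgeDir i u v = StepDir i u v ⊎ StepDir i v u

Adj : Vertex → Vertex → Set
Adj u v = ∃ λ i → EdgeDir i u v

FinSet : Set
FinSet = Σ (List Vertex) Unique

elems : FinSet → List Vertex
elems (L , _) = L

∣_∣ : FinSet → ℕ
∣ W ∣ = length (elems W)

HasCard : (Vertex → Set) → ℕ → Set
HasCard P n = Σ (List Vertex) λ L → Unique L × (∀ x → (x ∈ L) ⇔ P x) × length L ≡ n

𝒩 : FinSet → Vertex → Set
𝒩 W x = ¬ (x ∈ elems W) × ∃ λ y → y ∈ elems W × Adj x y

-- Deleting the edges of direction i, the remaining edges change
-- only the coordinates j ≠ i, so coordinate i is constant on each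
-- component; conversely each level set {v : coord i v ≡ r} is a single
-- bi-infinite zigzag path.  Hence the rows of direction i are exactly the
-- level sets of coord i, indexed by r ∈ ℤ, and their linear order across
-- the plane is the order of ℤ.

InRow : Direction → ℤ → Vertex → Set
InRow i r v = coord i v ≡ r

Gray : FinSet → Direction → ℤ → Set
Gray Z i r = ∃ λ z → z ∈ elems Z × InRow i r z

White : FinSet → Direction → ℤ → Set
White Z i r = ¬ Gray Z i r

Bad : FinSet → Direction → ℤ → Set
Bad Z i r = White Z i r × ∃ λ r₁ → ∃ λ r₂ →
  r₁ < r × r < r₂ × Gray Z i r₁ × Gray Z i r₂

NoBadRow : FinSet → Set
NoBadRow Z = ∀ i r → ¬ Bad Z i r

module Submission where

open import Defs
open import Data.Product using (Σ; ∃; _×_; _,_)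
open import Relation.Binary.PropositionalEquality using (_≡_)

open import Data.Bool using (Bool; true; false)
import Data.Bool.Properties as Bool
open import Data.Empty using (⊥; ⊥-elim)
open import Data.Fin.Patterns using (0F; 1F; 2F)
open import Data.Integer using (ℤ)
open import Data.List using (List; map)
open import Data.List.Membership.Propositional using (_∈_)
open import Data.List.Membership.Propositional.Properties using (∈-map⁺; ∈-map⁻; ∈-allFin)
open import Data.Nat using (ℕ; _≤_; _<_)
open import Data.Product using (proj₁; proj₂)
open import Data.Product.Properties using (≡-dec)
open import Data.Sum using (_⊎_; inj₁; inj₂)
open import Relation.Binary.Definitions using (DecidableEquality)
open import Relation.Binary.PropositionalEquality using (refl; sym; trans; cong; cong₂; subst; subst₂)
open import Relation.Nullary using (¬_)

-- Suppose the row r of direction i is white but has gray rows on both sides, and split W into the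
-- part A below r and the part B above it.  A vertex adjacent to both A and B would lie on row r and
-- would be the upper end of a direction-i edge as well as the lower end of one, which the
-- bipartition of the grid forbids; so 𝒩(A) and 𝒩(B) are disjoint parts of 𝒩(W).  Translating B by
-- e_j − e_i (j ≠ i) moves it one row towards A, keeps |W|, and gives
-- 𝒩(A ∪ (B + e_j − e_i)) ⊆ 𝒩(A) ∪ (𝒩(B) + e_j − e_i), so |𝒩| does not grow.  For each a ∈ A and
-- b ∈ B the two choices of j together shorten the ℓ₁ distance |a − b| in cube coordinates by at
-- least one on average, so one of them strictly decreases the sum Φ of all pairwise distances in W.
-- Iterating terminates, and the final set has no bad row.

module Grid where
  open import Data.Integer using (_+_; _-_; -_; 0ℤ; 1ℤ; suc) renaming (_<_ to _<ℤ_; _≤_ to _≤ℤ_)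
  import Data.Integer.Properties as ℤ
  open import Data.Integer.Tactic.RingSolver using (solve-∀)
  open import Data.List using (allFin)

  _≟ᵥ_ : DecidableEquality Vertex
  _≟ᵥ_ = ≡-dec ℤ._≟_ (≡-dec ℤ._≟_ Bool._≟_)

  side : Vertex → Bool
  side (_ , _ , s) = s

  level : Bool → ℤ
  level false = 0ℤ
  level true  = 1ℤ

  coordSum : Vertex → ℤ
  coordSum v = coord 0F v + coord 1F v + coord 2F v

  coordSum≡level : ∀ v → coordSum v ≡ level (side v)
  coordSum≡level (x , y , false) = lemma x y
    where lemma : ∀ x y → x + y + - (x + y) ≡ 0ℤ
          lemma = solve-∀
  coordSum≡level (x , y , true) = lemma x y
    where lemma : ∀ x y → x + y + (1ℤ - (x + y)) ≡ 1ℤ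
          lemma = solve-∀

  δ-sum : ∀ i → δ i 2F ≡ 1ℤ - (δ i 0F + δ i 1F)
  δ-sum 0F = refl
  δ-sum 1F = refl
  δ-sum 2F = refl

  StepDir⇒coordSum : ∀ {i u v} → StepDir i u v → coordSum v ≡ coordSum u + 1ℤ
  StepDir⇒coordSum {i} {u} s rewrite s 0F | s 1F | s 2F | δ-sum i =
    lemma (coord 0F u) (coord 1F u) (coord 2F u) (δ i 0F) (δ i 1F)
    where lemma : ∀ x y z d e → x + d + (y + e) + (z + (1ℤ - (d + e))) ≡ x + y + z + 1ℤ
          lemma = solve-∀

  level-suc : ∀ s t → level t ≡ level s + 1ℤ → s ≡ false × t ≡ true
  level-suc false true  _ = refl , refl
  level-suc false false ()
  level-suc true  false ()
  level-suc true  true  ()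

  StepDir⇒sides : ∀ {i u v} → StepDir i u v → side u ≡ false × side v ≡ true
  StepDir⇒sides {u = u} {v} s = level-suc (side u) (side v)
    (trans (sym (coordSum≡level v)) (trans (StepDir⇒coordSum s) (cong (_+ 1ℤ) (coordSum≡level u))))

  up down : Direction → Vertex → Vertex
  up   i (x , y , _) = x + δ i 0F , y + δ i 1F , true
  down i (x , y , _) = x - δ i 0F , y - δ i 1F , false

  up-StepDir : ∀ i x y → StepDir i (x , y , false) (up i (x , y , false))
  up-StepDir i x y 0F = refl
  up-StepDir i x y 1F = refl
  up-StepDir i x y 2F rewrite δ-sum i = lemma x y (δ i 0F) (δ i 1F)
    where lemma : ∀ x y d e → 1ℤ - (x + d + (y + e)) ≡ - (x + y) + (1ℤ - (d + e))
          lemma = solve-∀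

  x≡x-d+d : ∀ x d → x ≡ x - d + d
  x≡x-d+d = solve-∀

  x≡x+d-d : ∀ x d → x ≡ x + d - d
  x≡x+d-d = solve-∀

  down-StepDir : ∀ i x y → StepDir i (down i (x , y , true)) (x , y , true)
  down-StepDir i x y 0F = x≡x-d+d x (δ i 0F)
  down-StepDir i x y 1F = x≡x-d+d y (δ i 1F)
  down-StepDir i x y 2F rewrite δ-sum i = lemma x y (δ i 0F) (δ i 1F)
    where lemma : ∀ x y d e → 1ℤ - (x + y) ≡ - (x - d + (y - e)) + (1ℤ - (d + e))
          lemma = solve-∀

  StepDir⇒≡up : ∀ {i u v} → StepDir i u v → v ≡ up i u
  StepDir⇒≡up {u = _ , _ , _} {_ , _ , _} s =
    cong₂ _,_ (s 0F) (cong₂ _,_ (s 1F) (proj₂ (StepDir⇒sides s)))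

  StepDir⇒≡down : ∀ {i u v} → StepDir i u v → u ≡ down i v
  StepDir⇒≡down {i} {x , y , _} {_ , _ , _} s =
    cong₂ _,_ (trans (x≡x+d-d x (δ i 0F)) (cong (_- δ i 0F) (sym (s 0F))))
      (cong₂ _,_ (trans (x≡x+d-d y (δ i 1F)) (cong (_- δ i 1F) (sym (s 1F)))) (proj₁ (StepDir⇒sides s)))

  neighbour : Direction → Vertex → Vertex
  neighbour i v@(_ , _ , false) = up i v
  neighbour i v@(_ , _ , true)  = down i v

  neighbours : Vertex → List Vertex
  neighbours v = map (λ i → neighbour i v) (allFin 3)

  EdgeDir⇒≡neighbour : ∀ {i x y} → EdgeDir i x y → x ≡ neighbour i y
  EdgeDir⇒≡neighbour {y = _ , _ , b} (inj₁ s) with b | StepDir⇒≡down s | proj₂ (StepDir⇒sides s)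
  ... | true | x≡ | _ = x≡
  EdgeDir⇒≡neighbour {y = _ , _ , b} (inj₂ s) with b | StepDir⇒≡up s | proj₁ (StepDir⇒sides s)
  ... | false | x≡ | _ = x≡

  Adj⇒∈neighbours : ∀ {x y} → Adj x y → x ∈ neighbours y
  Adj⇒∈neighbours {y = y} (i , e) =
    subst (_∈ neighbours y) (sym (EdgeDir⇒≡neighbour e)) (∈-map⁺ (λ j → neighbour j y) (∈-allFin i))

  ∈neighbours⇒Adj : ∀ {x y} → x ∈ neighbours y → Adj x y
  ∈neighbours⇒Adj {y = y} x∈ with ∈-map⁻ (λ i → neighbour i y) x∈
  ∈neighbours⇒Adj {y = a , b , false} _ | i , _ , refl = i , inj₂ (up-StepDir i a b)
  ∈neighbours⇒Adj {y = a , b , true}  _ | i , _ , refl = i , inj₁ (down-StepDir i a b)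

  translate : ℤ × ℤ → Vertex → Vertex
  translate (p , q) (x , y , s) = x + p , y + q , s

  offset : Direction → ℤ × ℤ → ℤ
  offset 0F (p , q) = p
  offset 1F (p , q) = q
  offset 2F (p , q) = - (p + q)

  coord-translate : ∀ j t v → coord j (translate t v) ≡ coord j v + offset j t
  coord-translate 0F _ _ = refl
  coord-translate 1F _ _ = refl
  coord-translate 2F (p , q) (x , y , false) = lemma x y p q
    where lemma : ∀ x y p q → - (x + p + (y + q)) ≡ - (x + y) + - (p + q)
          lemma = solve-∀
  coord-translate 2F (p , q) (x , y , true) = lemma x y p q
    where lemma : ∀ x y p q → 1ℤ - (x + p + (y + q)) ≡ 1ℤ - (x + y) + - (p + q)
          lemma = solve-∀

  translate-StepDir : ∀ {i u v} t → StepDir i u v → StepDir i (translate t u) (translate t v)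
  translate-StepDir {i} {u} {v} t s j rewrite coord-translate j t u | coord-translate j t v | s j =
    lemma (coord j u) (δ i j) (offset j t)
    where lemma : ∀ c d o → c + d + o ≡ c + o + d
          lemma = solve-∀

  translate-Adj : ∀ {u v} t → Adj u v → Adj (translate t u) (translate t v)
  translate-Adj t (i , inj₁ s) = i , inj₁ (translate-StepDir t s)
  translate-Adj t (i , inj₂ s) = i , inj₂ (translate-StepDir t s)

  negate : ℤ × ℤ → ℤ × ℤ
  negate (p , q) = - p , - q

  translate-negate : ∀ t v → translate (negate t) (translate t v) ≡ v
  translate-negate (p , q) (x , y , s) = cong₂ _,_ (lemma x p) (cong₂ _,_ (lemma y q) refl)
    where lemma : ∀ x p → x + p + - p ≡ x
          lemma = solve-∀

  translate-negate⁻ : ∀ t v → translate t (translate (negate t) v) ≡ v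
  translate-negate⁻ (p , q) (x , y , s) = cong₂ _,_ (lemma x p) (cong₂ _,_ (lemma y q) refl)
    where lemma : ∀ x p → x + - p + p ≡ x
          lemma = solve-∀

  translate-injective : ∀ t {u v} → translate t u ≡ translate t v → u ≡ v
  translate-injective t {u} {v} eq =
    trans (sym (translate-negate t u)) (trans (cong (translate (negate t)) eq) (translate-negate t v))

  δ-cases : ∀ j i → δ j i ≡ 0ℤ ⊎ δ j i ≡ 1ℤ
  δ-cases 0F 0F = inj₂ refl
  δ-cases 0F 1F = inj₁ refl
  δ-cases 0F 2F = inj₁ refl
  δ-cases 1F 0F = inj₁ refl
  δ-cases 1F 1F = inj₂ refl
  δ-cases 1F 2F = inj₁ refl
  δ-cases 2F 0F = inj₁ refl
  δ-cases 2F 1F = inj₁ refl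
  δ-cases 2F 2F = inj₂ refl

  StepDir⇒coord≡ : ∀ {j u v} i → StepDir j u v → coord i v ≡ coord i u ⊎ coord i v ≡ suc (coord i u)
  StepDir⇒coord≡ {j} {u} i s with δ-cases j i
  ... | inj₁ δ≡0 = inj₁ (trans (s i) (trans (cong (coord i u +_) δ≡0) (ℤ.+-identityʳ (coord i u))))
  ... | inj₂ δ≡1 = inj₂ (trans (s i) (trans (cong (coord i u +_) δ≡1) (ℤ.+-comm (coord i u) 1ℤ)))

  StepDir⇒coord≤ : ∀ {j u v} i → StepDir j u v → coord i u ≤ℤ coord i v
  StepDir⇒coord≤ i s with StepDir⇒coord≡ i s
  ... | inj₁ eq = ℤ.≤-reflexive (sym eq)
  ... | inj₂ eq = subst (_ ≤ℤ_) (sym eq) (ℤ.i≤suc[i] _)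

  StepDir⇒coord≤suc : ∀ {j u v} i → StepDir j u v → coord i v ≤ℤ suc (coord i u)
  StepDir⇒coord≤suc i s with StepDir⇒coord≡ i s
  ... | inj₁ eq = subst (_≤ℤ _) (sym eq) (ℤ.i≤suc[i] _)
  ... | inj₂ eq = ℤ.≤-reflexive eq

  Adj-sym : ∀ {u v} → Adj u v → Adj v u
  Adj-sym (j , inj₁ s) = j , inj₂ s
  Adj-sym (j , inj₂ s) = j , inj₁ s

  Adj⇒coord≤suc : ∀ {u v} i → Adj u v → coord i u ≤ℤ suc (coord i v)
  Adj⇒coord≤suc i (j , inj₁ s) = ℤ.≤-trans (StepDir⇒coord≤ i s) (ℤ.i≤suc[i] _)
  Adj⇒coord≤suc i (j , inj₂ s) = StepDir⇒coord≤suc i s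

  Adj⇒StepDir : ∀ {u v} i → Adj u v → coord i u <ℤ coord i v → ∃ λ j → StepDir j u v
  Adj⇒StepDir i (j , inj₁ s) _   = j , s
  Adj⇒StepDir i (j , inj₂ s) u<v = ⊥-elim (ℤ.<⇒≱ u<v (StepDir⇒coord≤ i s))

  Adj-below : ∀ {x a r} i → Adj x a → coord i a <ℤ r → coord i x ≤ℤ r
  Adj-below i adj a<r = ℤ.≤-trans (Adj⇒coord≤suc i adj) (ℤ.i<j⇒suc[i]≤j a<r)

  Adj-above : ∀ {x b r} i → Adj x b → r <ℤ coord i b → r ≤ℤ coord i x
  Adj-above i adj r<b =
    subst (_ ≤ℤ_) (ℤ.pred-suc _) (ℤ.i<j⇒i≤pred[j] (ℤ.<-≤-trans r<b (Adj⇒coord≤suc i (Adj-sym adj))))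

  -- x lies on row r, so it is the upper end of an edge from a and the lower end of an edge to b:
  -- its coordinate sum would have to be both 1 and 0.
  ¬Adj-straddle : ∀ {x a b r} i → Adj x a → Adj x b → coord i a <ℤ r → r <ℤ coord i b → ⊥
  ¬Adj-straddle {x} i adjᵃ adjᵇ a<r r<b
    with Adj⇒StepDir i (Adj-sym adjᵃ) (ℤ.<-≤-trans a<r (Adj-above i adjᵇ r<b))
       | Adj⇒StepDir i adjᵇ (ℤ.≤-<-trans (Adj-below i adjᵃ a<r) r<b)
  ... | _ , a→x | _ , x→b with side x | proj₂ (StepDir⇒sides a→x) | proj₁ (StepDir⇒sides x→b)
  ... | true | _ | ()

open Grid

module Counting where
  open import Data.Nat using (ℕ; suc; _≤_; z≤n; s≤s)
  open import Data.Nat.Properties using (module ≤-Reasoning)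
  open import Data.List using (List; []; _∷_; length; filter; concatMap; deduplicate)
  open import Data.List.Properties using (length-removeAt′)
  open import Data.List.Relation.Unary.All using (lookup)
  open import Data.List.Relation.Unary.AllPairs using (_∷_)
  open import Data.List.Relation.Unary.Any using (here; there; index; _─_)
  open import Data.List.Relation.Unary.Unique.Propositional using (Unique)
  open import Data.List.Relation.Unary.Unique.DecPropositional.Properties _≟ᵥ_ using (deduplicate-!)
  open import Data.List.Relation.Binary.Subset.Propositional using (_⊆_)
  open import Data.List.Membership.DecPropositional _≟ᵥ_ using (_∈?_)
  open import Data.List.Membership.Propositional.Properties
    using (∈-filter⁺; ∈-filter⁻; ∈-deduplicate⁺; ∈-deduplicate⁻; ∈-concatMap⁺; ∈-concatMap⁻)
  open import Data.List.Membership.Propositional using (find; lose)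
  open import Function.Bundles using (mk⇔)
  open import Relation.Binary.PropositionalEquality using (_≢_)
  open import Relation.Nullary.Decidable using (¬?)

  ∈-─ : ∀ {A : Set} {x z : A} {ys} (x∈ys : x ∈ ys) → z ∈ ys → z ≢ x → z ∈ (ys ─ x∈ys)
  ∈-─ (here refl) (here refl) z≢x = ⊥-elim (z≢x refl)
  ∈-─ (here _)    (there z∈)  _   = z∈
  ∈-─ (there _)   (here refl) _   = here refl
  ∈-─ (there x∈)  (there z∈)  z≢x = there (∈-─ x∈ z∈ z≢x)

  Unique-⊆⇒length≤ : ∀ {A : Set} {xs ys : List A} → Unique xs → xs ⊆ ys → length xs ≤ length ys
  Unique-⊆⇒length≤ {xs = []} _ _ = z≤n
  Unique-⊆⇒length≤ {xs = x ∷ xs} {ys} (x∉xs ∷ unique) xs⊆ys = begin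
    suc (length xs)         ≤⟨ s≤s (Unique-⊆⇒length≤ unique xs⊆ys─x) ⟩
    suc (length (ys ─ x∈ys)) ≡⟨ sym (length-removeAt′ ys (index x∈ys)) ⟩
    length ys               ∎
    where
    open ≤-Reasoning
    x∈ys = xs⊆ys (here refl)
    xs⊆ys─x : xs ⊆ (ys ─ x∈ys)
    xs⊆ys─x z∈xs = ∈-─ x∈ys (xs⊆ys (there z∈xs)) (λ z≡x → lookup x∉xs z∈xs (sym z≡x))

  neighbourhood : FinSet → List Vertex
  neighbourhood W = deduplicate _≟ᵥ_ (filter (λ x → ¬? (x ∈? elems W)) (concatMap neighbours (elems W)))

  ∈neighbourhood⇒𝒩 : ∀ W {x} → x ∈ neighbourhood W → 𝒩 W x
  ∈neighbourhood⇒𝒩 W x∈ with ∈-filter⁻ (λ x → ¬? (x ∈? elems W)) (∈-deduplicate⁻ _≟ᵥ_ _ x∈)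
  ... | x∈nbs , x∉W with find (∈-concatMap⁻ neighbours {xs = elems W} x∈nbs)
  ... | y , y∈W , x∈nb = x∉W , y , y∈W , ∈neighbours⇒Adj x∈nb

  𝒩⇒∈neighbourhood : ∀ W {x} → 𝒩 W x → x ∈ neighbourhood W
  𝒩⇒∈neighbourhood W (x∉W , y , y∈W , adj) =
    ∈-deduplicate⁺ _≟ᵥ_ (∈-filter⁺ (λ x → ¬? (x ∈? elems W))
      (∈-concatMap⁺ neighbours (lose y∈W (Adj⇒∈neighbours adj))) x∉W)

  neighbourhood-unique : ∀ W → Unique (neighbourhood W)
  neighbourhood-unique W = deduplicate-! _

  ∣𝒩_∣ : FinSet → ℕ
  ∣𝒩 W ∣ = length (neighbourhood W)

  𝒩-hasCard : ∀ W → HasCard (𝒩 W) ∣𝒩 W ∣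
  𝒩-hasCard W =
    neighbourhood W , neighbourhood-unique W , (λ x → mk⇔ (∈neighbourhood⇒𝒩 W) (𝒩⇒∈neighbourhood W)) , refl

  ∣𝒩∣≤length : ∀ W {ys} → (∀ {x} → 𝒩 W x → x ∈ ys) → ∣𝒩 W ∣ ≤ length ys
  ∣𝒩∣≤length W 𝒩⊆ys =
    Unique-⊆⇒length≤ (neighbourhood-unique W) (λ x∈ → 𝒩⊆ys (∈neighbourhood⇒𝒩 W x∈))

open Counting

module Sums where
  open import Data.Nat using (ℕ; suc; _+_; _≤_; _<_; z≤n)
  open import Data.Nat.Properties
    using (_<?_; +-assoc; +-mono-≤; +-mono-<-≤; +-mono-≤-<; +-monoˡ-≤; +-cancelˡ-<; <-≤-trans; ≮⇒≥; <⇒≤)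
  open import Data.Nat.Tactic.RingSolver using (solve-∀)
  open import Data.List using (List; []; _∷_; _++_; filter; length)
  open import Data.List.Relation.Unary.Any using (here; there)
  open import Function using (_∘_)
  open import Relation.Nullary using (yes; no)
  open import Relation.Nullary.Decidable using (¬?)
  open import Relation.Unary using (Pred; Decidable)
  open import Relation.Binary.PropositionalEquality using (module ≡-Reasoning)

  private variable
    A B : Set
    x y : A
    xs ys zs : List A

  ∑ : List A → (A → ℕ) → ℕ
  ∑ []       f = 0
  ∑ (x ∷ xs) f = f x + ∑ xs f

  ∑-++ : ∀ (xs ys : List A) f → ∑ (xs ++ ys) f ≡ ∑ xs f + ∑ ys f
  ∑-++ []       ys f = refl
  ∑-++ (x ∷ xs) ys f = trans (cong (f x +_) (∑-++ xs ys f)) (sym (+-assoc (f x) _ _))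

  ∑-map : ∀ (g : B → A) xs f → ∑ (map g xs) f ≡ ∑ xs (f ∘ g)
  ∑-map g []       f = refl
  ∑-map g (x ∷ xs) f = cong (f (g x) +_) (∑-map g xs f)

  ∑-cong : ∀ (xs : List A) {f g} → (∀ x → f x ≡ g x) → ∑ xs f ≡ ∑ xs g
  ∑-cong []       f≗g = refl
  ∑-cong (x ∷ xs) f≗g = cong₂ _+_ (f≗g x) (∑-cong xs f≗g)

  ∑-distrib-+ : ∀ (xs : List A) f g → ∑ xs (λ x → f x + g x) ≡ ∑ xs f + ∑ xs g
  ∑-distrib-+ []       f g = refl
  ∑-distrib-+ (x ∷ xs) f g =
    trans (cong (f x + g x +_) (∑-distrib-+ xs f g)) (lemma (f x) (g x) (∑ xs f) (∑ xs g))
    where lemma : ∀ a b c d → a + b + (c + d) ≡ a + c + (b + d)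
          lemma = solve-∀

  ∑-1≡length : ∀ (xs : List A) → ∑ xs (λ _ → 1) ≡ length xs
  ∑-1≡length []       = refl
  ∑-1≡length (x ∷ xs) = cong suc (∑-1≡length xs)

  ∑-mono-≤ : ∀ {xs : List A} {f g} → (∀ {x} → x ∈ xs → f x ≤ g x) → ∑ xs f ≤ ∑ xs g
  ∑-mono-≤ {xs = []}    _   = z≤n
  ∑-mono-≤ {xs = _ ∷ _} f≤g = +-mono-≤ (f≤g (here refl)) (∑-mono-≤ (f≤g ∘ there))

  ∑-mono-< : ∀ {xs : List A} {f g} → (∀ {x} → x ∈ xs → f x ≤ g x) → x ∈ xs → f x < g x →
             ∑ xs f < ∑ xs g
  ∑-mono-< f≤g (here refl) fx<gx = +-mono-<-≤ fx<gx (∑-mono-≤ (f≤g ∘ there))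
  ∑-mono-< f≤g (there x∈) fx<gx = +-mono-≤-< (f≤g (here refl)) (∑-mono-< (f≤g ∘ there) x∈ fx<gx)

  record Splits (zs xs ys : List A) : Set where
    constructor splits
    field ∑-split : ∀ f → ∑ zs f ≡ ∑ xs f + ∑ ys f
  open Splits

  ++-Splits : ∀ (xs ys : List A) → Splits (xs ++ ys) xs ys
  ++-Splits xs ys = splits (∑-++ xs ys)

  ∑-filter : ∀ {p} {P : Pred A p} (P? : Decidable P) xs f →
             ∑ xs f ≡ ∑ (filter P? xs) f + ∑ (filter (¬? ∘ P?) xs) f
  ∑-filter P? []       f = refl
  ∑-filter P? (x ∷ xs) f with P? x
  ... | yes _ = trans (cong (f x +_) (∑-filter P? xs f)) (sym (+-assoc (f x) _ _))
  ... | no  _ = trans (cong (f x +_) (∑-filter P? xs f))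
                      (lemma (f x) (∑ (filter P? xs) f) (∑ (filter (¬? ∘ P?) xs) f))
    where lemma : ∀ a b c → a + (b + c) ≡ b + (a + c)
          lemma = solve-∀

  filter-Splits : ∀ {p} {P : Pred A p} (P? : Decidable P) xs →
                  Splits xs (filter P? xs) (filter (¬? ∘ P?) xs)
  filter-Splits P? xs = splits (∑-filter P? xs)

  Splits⇒length : Splits zs xs ys → length zs ≡ length xs + length ys
  Splits⇒length {zs = zs} {xs} {ys} split = begin
    length zs                        ≡⟨ sym (∑-1≡length zs) ⟩
    ∑ zs (λ _ → 1)                   ≡⟨ ∑-split split (λ _ → 1) ⟩
    ∑ xs (λ _ → 1) + ∑ ys (λ _ → 1)  ≡⟨ cong₂ _+_ (∑-1≡length xs) (∑-1≡length ys) ⟩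
    length xs + length ys            ∎
    where open ≡-Reasoning

  x+y<z+z⇒x<z⊎y<z : ∀ {x y z} → x + y < z + z → x < z ⊎ y < z
  x+y<z+z⇒x<z⊎y<z {x} {y} {z} x+y< with x <? z
  ... | yes x<z = inj₁ x<z
  ... | no  x≮z = inj₂ (+-cancelˡ-< x y z (<-≤-trans x+y< (+-monoˡ-≤ z (≮⇒≥ x≮z))))

  ∑∑ : (A → B → ℕ) → List A → List B → ℕ
  ∑∑ f xs ys = ∑ xs (λ x → ∑ ys (f x))

  ∑∑-Splits : ∀ {zs xs ys : List A} → Splits zs xs ys → ∀ f →
              ∑∑ f zs zs ≡ (∑∑ f xs xs + ∑∑ f ys ys) + (∑∑ f xs ys + ∑∑ f ys xs)
  ∑∑-Splits {zs = zs} {xs} {ys} split f = begin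
    ∑ zs (λ z → ∑ zs (f z))
      ≡⟨ ∑-cong zs (λ z → ∑-split split (f z)) ⟩
    ∑ zs (λ z → ∑ xs (f z) + ∑ ys (f z))
      ≡⟨ ∑-distrib-+ zs _ _ ⟩
    ∑ zs (λ z → ∑ xs (f z)) + ∑ zs (λ z → ∑ ys (f z))
      ≡⟨ cong₂ _+_ (∑-split split _) (∑-split split _) ⟩
    (∑∑ f xs xs + ∑∑ f ys xs) + (∑∑ f xs ys + ∑∑ f ys ys)
      ≡⟨ lemma (∑∑ f xs xs) (∑∑ f ys xs) (∑∑ f xs ys) (∑∑ f ys ys) ⟩
    (∑∑ f xs xs + ∑∑ f ys ys) + (∑∑ f xs ys + ∑∑ f ys xs) ∎
    where
    open ≡-Reasoning
    lemma : ∀ a b c d → (a + b) + (c + d) ≡ (a + d) + (c + b)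
    lemma = solve-∀

  ∑∑-mapˡ : ∀ (g : A → B) {C : Set} (f : B → C → ℕ) xs ys →
            ∑∑ f (map g xs) ys ≡ ∑∑ (f ∘ g) xs ys
  ∑∑-mapˡ g f xs ys = ∑-map g xs _

  ∑∑-mapʳ : ∀ (g : B → A) {C : Set} (f : C → A → ℕ) xs ys →
            ∑∑ f xs (map g ys) ≡ ∑∑ (λ x → f x ∘ g) xs ys
  ∑∑-mapʳ g f xs ys = ∑-cong xs (λ x → ∑-map g ys (f x))

  ∑∑-cong : ∀ {f g : A → B → ℕ} xs ys → (∀ x y → f x y ≡ g x y) → ∑∑ f xs ys ≡ ∑∑ g xs ys
  ∑∑-cong xs ys f≗g = ∑-cong xs (λ x → ∑-cong ys (f≗g x))

  ∑∑-distrib-+ : ∀ (f g : A → B → ℕ) xs ys →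
                 ∑∑ (λ x y → f x y + g x y) xs ys ≡ ∑∑ f xs ys + ∑∑ g xs ys
  ∑∑-distrib-+ f g xs ys = trans (∑-cong xs (λ x → ∑-distrib-+ ys (f x) (g x))) (∑-distrib-+ xs _ _)

  ∑∑-mono-< : ∀ {xs : List A} {ys : List B} {f g} → (∀ {x y} → x ∈ xs → y ∈ ys → f x y < g x y) →
              x ∈ xs → y ∈ ys → ∑∑ f xs ys < ∑∑ g xs ys
  ∑∑-mono-< {xs = xs} {ys} {f} {g} f<g x∈ y∈ =
    ∑-mono-< (λ x∈ → <⇒≤ (rows< x∈)) x∈ (rows< x∈)
    where rows< : ∀ {x} → x ∈ xs → ∑ ys (f x) < ∑ ys (g x)
          rows< x∈ = ∑-mono-< (λ y∈ → <⇒≤ (f<g x∈ y∈)) y∈ (f<g x∈ y∈)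

open Sums

module Distance where
  open import Data.Nat using (ℕ; suc; _+_; _≤_; _<_; s≤s; z≤n)
  import Data.Nat.Properties as ℕ
  open import Data.Nat.Tactic.RingSolver using () renaming (solve-∀ to ℕ-solve-∀)
  open import Data.Integer as ℤ using (+_; -[1+_]; 0ℤ; 1ℤ; -1ℤ; _-_; -_)
    renaming (∣_∣ to ∣_∣ℤ; _+_ to _+ℤ_; _<_ to _<ℤ_; _≤_ to _≤ℤ_)
  import Data.Integer.Properties as ℤ
  open import Data.Integer.Tactic.RingSolver using (solve-∀)
  open import Relation.Nullary using (yes; no)

  ∣i+1∣+1≡∣i∣ : ∀ {i} → i <ℤ 0ℤ → ∣ i +ℤ 1ℤ ∣ℤ + 1 ≡ ∣ i ∣ℤ
  ∣i+1∣+1≡∣i∣ { -[1+ 0 ] }     _ = refl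
  ∣i+1∣+1≡∣i∣ { -[1+ suc n ] } _ = ℕ.+-comm (suc n) 1
  ∣i+1∣+1≡∣i∣ { + _ } (ℤ.+<+ ())

  ∣i-1∣+1≡∣i∣ : ∀ {i} → 0ℤ <ℤ i → ∣ i - 1ℤ ∣ℤ + 1 ≡ ∣ i ∣ℤ
  ∣i-1∣+1≡∣i∣ {+ suc n} _ = ℕ.+-comm n 1
  ∣i-1∣+1≡∣i∣ {+ 0} (ℤ.+<+ ())

  ∣i-0∣≡∣i∣ : ∀ i → ∣ i - 0ℤ ∣ℤ ≡ ∣ i ∣ℤ
  ∣i-0∣≡∣i∣ i = cong ∣_∣ℤ (ℤ.+-identityʳ i)

  0<i⇒∣i-1∣+∣j-1∣≤∣i∣+∣j∣ : ∀ {i} j → 0ℤ <ℤ i →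
                            ∣ i - 1ℤ ∣ℤ + ∣ j - 1ℤ ∣ℤ ≤ ∣ i ∣ℤ + ∣ j ∣ℤ
  0<i⇒∣i-1∣+∣j-1∣≤∣i∣+∣j∣ {i} j 0<i = begin
    ∣ i - 1ℤ ∣ℤ + ∣ j - 1ℤ ∣ℤ      ≤⟨ ℕ.+-monoʳ-≤ ∣ i - 1ℤ ∣ℤ (ℤ.∣i-j∣≤∣i∣+∣j∣ j 1ℤ) ⟩
    ∣ i - 1ℤ ∣ℤ + (∣ j ∣ℤ + 1)     ≡⟨ lemma ∣ i - 1ℤ ∣ℤ ∣ j ∣ℤ ⟩
    ∣ i - 1ℤ ∣ℤ + 1 + ∣ j ∣ℤ       ≡⟨ cong (_+ ∣ j ∣ℤ) (∣i-1∣+1≡∣i∣ 0<i) ⟩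
    ∣ i ∣ℤ + ∣ j ∣ℤ                ∎
    where
    open ℕ.≤-Reasoning
    lemma : ∀ a b → a + (b + 1) ≡ a + 1 + b
    lemma = ℕ-solve-∀

  ∣i-1∣+∣j-1∣≤∣i∣+∣j∣ : ∀ {i j} → 0ℤ <ℤ i +ℤ j →
                        ∣ i - 1ℤ ∣ℤ + ∣ j - 1ℤ ∣ℤ ≤ ∣ i ∣ℤ + ∣ j ∣ℤ
  ∣i-1∣+∣j-1∣≤∣i∣+∣j∣ {i} {j} 0<i+j with 0ℤ ℤ.<? i
  ... | yes 0<i = 0<i⇒∣i-1∣+∣j-1∣≤∣i∣+∣j∣ j 0<i
  ... | no  0≮i = subst₂ _≤_ (ℕ.+-comm ∣ j - 1ℤ ∣ℤ ∣ i - 1ℤ ∣ℤ) (ℕ.+-comm ∣ j ∣ℤ ∣ i ∣ℤ)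
                          (0<i⇒∣i-1∣+∣j-1∣≤∣i∣+∣j∣ i 0<j)
    where
    0<j : 0ℤ <ℤ j
    0<j = ℤ.<-≤-trans 0<i+j (subst (i +ℤ j ≤ℤ_) (ℤ.+-identityˡ j) (ℤ.+-monoˡ-≤ j (ℤ.≮⇒≥ 0≮i)))

  ℓ₁ : ℤ × ℤ × ℤ → ℕ
  ℓ₁ (x , y , z) = ∣ x ∣ℤ + ∣ y ∣ℤ + ∣ z ∣ℤ

  ℓ₁-rotate : ∀ x y z → ℓ₁ (x , y , z) ≡ ℓ₁ (y , z , x)
  ℓ₁-rotate x y z = lemma ∣ x ∣ℤ ∣ y ∣ℤ ∣ z ∣ℤ
    where lemma : ∀ a b c → a + b + c ≡ b + c + a
          lemma = ℕ-solve-∀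

  -- The two vectors subtracted are e₂ − e₁ and e₃ − e₁ in cube coordinates.
  ℓ₁-shift : ∀ {x y z} → x <ℤ -1ℤ → -1ℤ ≤ℤ x +ℤ y +ℤ z →
             ℓ₁ (x - -1ℤ , y - 1ℤ , z - 0ℤ) + ℓ₁ (x - -1ℤ , y - 0ℤ , z - 1ℤ)
               < ℓ₁ (x , y , z) + ℓ₁ (x , y , z)
  ℓ₁-shift {x} {y} {z} x<-1 -1≤sum = begin-strict
    ℓ₁ (x - -1ℤ , y - 1ℤ , z - 0ℤ) + ℓ₁ (x - -1ℤ , y - 0ℤ , z - 1ℤ)
      ≡⟨ cong₂ _+_ (cong (λ w → X + J + w) (∣i-0∣≡∣i∣ z)) (cong (λ w → X + w + K) (∣i-0∣≡∣i∣ y)) ⟩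
    (X + J + Z) + (X + Y + K)
      ≡⟨ regroup X J Z Y K ⟩
    (X + X + (Y + Z)) + (J + K)
      ≤⟨ ℕ.+-monoʳ-≤ (X + X + (Y + Z)) (∣i-1∣+∣j-1∣≤∣i∣+∣j∣ {y} {z} 0<y+z) ⟩
    (X + X + (Y + Z)) + (Y + Z)
      <⟨ ℕ.m<m+n _ (s≤s z≤n) ⟩
    (X + X + (Y + Z)) + (Y + Z) + 2
      ≡⟨ regroup′ X Y Z ⟩
    (X + 1 + Y + Z) + (X + 1 + Y + Z)
      ≡⟨ cong (λ w → (w + Y + Z) + (w + Y + Z)) (∣i+1∣+1≡∣i∣ x<0) ⟩
    ℓ₁ (x , y , z) + ℓ₁ (x , y , z)
      ∎
    where
    open ℕ.≤-Reasoning
    X = ∣ x +ℤ 1ℤ ∣ℤ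
    Y = ∣ y ∣ℤ
    Z = ∣ z ∣ℤ
    J = ∣ y - 1ℤ ∣ℤ
    K = ∣ z - 1ℤ ∣ℤ
    x<0 : x <ℤ 0ℤ
    x<0 = ℤ.<-trans x<-1 (ℤ.-<+ {0} {0})
    0<y+z : 0ℤ <ℤ y +ℤ z
    0<y+z = subst (0ℤ <ℤ_) (lemma x y z) (ℤ.+-mono-≤-< -1≤sum (ℤ.neg-mono-< x<-1))
      where lemma : ∀ x y z → x +ℤ y +ℤ z +ℤ - x ≡ y +ℤ z
            lemma = solve-∀
    regroup : ∀ X J Z Y K → (X + J + Z) + (X + Y + K) ≡ (X + X + (Y + Z)) + (J + K)
    regroup = ℕ-solve-∀
    regroup′ : ∀ X Y Z → (X + X + (Y + Z)) + (Y + Z) + 2 ≡ (X + 1 + Y + Z) + (X + 1 + Y + Z)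
    regroup′ = ℕ-solve-∀

  Δ : Direction → Vertex → Vertex → ℤ
  Δ ℓ u v = coord ℓ u - coord ℓ v

  dist : Vertex → Vertex → ℕ
  dist u v = ℓ₁ (Δ 0F u v , Δ 1F u v , Δ 2F u v)

  dist-sym : ∀ u v → dist u v ≡ dist v u
  dist-sym u v = cong₂ _+_ (cong₂ _+_ (sym-at 0F) (sym-at 1F)) (sym-at 2F)
    where sym-at : ∀ ℓ → ∣ Δ ℓ u v ∣ℤ ≡ ∣ Δ ℓ v u ∣ℤ
          sym-at ℓ = ℤ.∣i-j∣≡∣j-i∣ (coord ℓ u) (coord ℓ v)

  Δ-translateʳ : ∀ ℓ t u v → Δ ℓ u (translate t v) ≡ Δ ℓ u v - offset ℓ t
  Δ-translateʳ ℓ t u v rewrite coord-translate ℓ t v =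
    lemma (coord ℓ u) (coord ℓ v) (offset ℓ t)
    where lemma : ∀ a b c → a - (b +ℤ c) ≡ a - b - c
          lemma = solve-∀

  Δ-translate : ∀ ℓ t u v → Δ ℓ (translate t u) (translate t v) ≡ Δ ℓ u v
  Δ-translate ℓ t u v rewrite coord-translate ℓ t u | coord-translate ℓ t v =
    lemma (coord ℓ u) (coord ℓ v) (offset ℓ t)
    where lemma : ∀ a b c → a +ℤ c - (b +ℤ c) ≡ a - b
          lemma = solve-∀

  dist-translateʳ : ∀ t u v →
    dist u (translate t v) ≡ ℓ₁ (Δ 0F u v - offset 0F t , Δ 1F u v - offset 1F t , Δ 2F u v - offset 2F t)
  dist-translateʳ t u v =
    cong ℓ₁ (cong₂ _,_ (Δ-translateʳ 0F t u v) (cong₂ _,_ (Δ-translateʳ 1F t u v) (Δ-translateʳ 2F t u v)))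

  dist-translate : ∀ t u v → dist (translate t u) (translate t v) ≡ dist u v
  dist-translate t u v =
    cong ℓ₁ (cong₂ _,_ (Δ-translate 0F t u v) (cong₂ _,_ (Δ-translate 1F t u v) (Δ-translate 2F t u v)))

  -1≤level-level : ∀ s s′ → -1ℤ ≤ℤ level s - level s′
  -1≤level-level false false = ℤ.-≤+
  -1≤level-level false true  = ℤ.≤-refl
  -1≤level-level true  false = ℤ.-≤+
  -1≤level-level true  true  = ℤ.-≤+

  -1≤ΣΔ : ∀ u v → -1ℤ ≤ℤ Δ 0F u v +ℤ Δ 1F u v +ℤ Δ 2F u v
  -1≤ΣΔ u v = subst (-1ℤ ≤ℤ_) (sym ΣΔ≡) (-1≤level-level (side u) (side v))
    where
    lemma : ∀ a b c a′ b′ c′ → a - a′ +ℤ (b - b′) +ℤ (c - c′) ≡ (a +ℤ b +ℤ c) - (a′ +ℤ b′ +ℤ c′)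
    lemma = solve-∀
    ΣΔ≡ : Δ 0F u v +ℤ Δ 1F u v +ℤ Δ 2F u v ≡ level (side u) - level (side v)
    ΣΔ≡ = trans (lemma (coord 0F u) (coord 1F u) (coord 2F u) (coord 0F v) (coord 1F v) (coord 2F v))
                (cong₂ _-_ (coordSum≡level u) (coordSum≡level v))

  Δ<-1 : ∀ i {a b r} → coord i a <ℤ r → r <ℤ coord i b → Δ i a b <ℤ -1ℤ
  Δ<-1 i {a} {b} a<r r<b = subst (Δ i a b <ℤ_) (lemma (coord i b))
      (ℤ.+-monoˡ-< (- coord i b) (ℤ.<-≤-trans a<r (ℤ.i<j⇒i≤pred[j] r<b)))
    where lemma : ∀ c → -1ℤ +ℤ c - c ≡ -1ℤ
          lemma = solve-∀

  -- The translations by e_{i+1} − e_i and e_{i+2} − e_i (indices mod 3), written as (x , y) offsets.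
  shift₁ shift₂ : Direction → ℤ × ℤ
  shift₁ 0F = -1ℤ , 1ℤ
  shift₁ 1F = 0ℤ , -1ℤ
  shift₁ 2F = 1ℤ , 0ℤ
  shift₂ 0F = -1ℤ , 0ℤ
  shift₂ 1F = 1ℤ , -1ℤ
  shift₂ 2F = 0ℤ , 1ℤ

  offset-shift₁ : ∀ i → offset i (shift₁ i) ≡ -1ℤ
  offset-shift₁ 0F = refl
  offset-shift₁ 1F = refl
  offset-shift₁ 2F = refl

  offset-shift₂ : ∀ i → offset i (shift₂ i) ≡ -1ℤ
  offset-shift₂ 0F = refl
  offset-shift₂ 1F = refl
  offset-shift₂ 2F = refl

  dist-shift : ∀ i {a b r} → coord i a <ℤ r → r <ℤ coord i b →
               dist a (translate (shift₁ i) b) + dist a (translate (shift₂ i) b) < dist a b + dist a b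
  dist-shift i {a} {b} a<r r<b =
    subst₂ _<_ (sym (cong₂ _+_ (dist-translateʳ (shift₁ i) a b) (dist-translateʳ (shift₂ i) a b)))
               refl (rotated i (Δ<-1 i a<r r<b))
    where
    e₀ = Δ 0F a b
    e₁ = Δ 1F a b
    e₂ = Δ 2F a b
    sum-rotate : ∀ x y z → x +ℤ y +ℤ z ≡ y +ℤ z +ℤ x
    sum-rotate = solve-∀
    rotated : ∀ i → Δ i a b <ℤ -1ℤ →
      ℓ₁ (e₀ - offset 0F (shift₁ i) , e₁ - offset 1F (shift₁ i) , e₂ - offset 2F (shift₁ i)) +
      ℓ₁ (e₀ - offset 0F (shift₂ i) , e₁ - offset 1F (shift₂ i) , e₂ - offset 2F (shift₂ i))
        < dist a b + dist a b
    rotated 0F e₀<-1 = ℓ₁-shift e₀<-1 (-1≤ΣΔ a b)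
    rotated 1F e₁<-1 =
      subst₂ _<_ (sym (cong₂ _+_ (ℓ₁-rotate (e₀ - 0ℤ) (e₁ - -1ℤ) (e₂ - 1ℤ))
                                 (ℓ₁-rotate (e₀ - 1ℤ) (e₁ - -1ℤ) (e₂ - 0ℤ))))
                 (sym (cong₂ _+_ (ℓ₁-rotate e₀ e₁ e₂) (ℓ₁-rotate e₀ e₁ e₂)))
        (ℓ₁-shift e₁<-1 (subst (-1ℤ ≤ℤ_) (sum-rotate e₀ e₁ e₂) (-1≤ΣΔ a b)))
    rotated 2F e₂<-1 =
      subst₂ _<_ (cong₂ _+_ (ℓ₁-rotate (e₂ - -1ℤ) (e₀ - 1ℤ) (e₁ - 0ℤ))
                            (ℓ₁-rotate (e₂ - -1ℤ) (e₀ - 0ℤ) (e₁ - 1ℤ)))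
                 (cong₂ _+_ (ℓ₁-rotate e₂ e₀ e₁) (ℓ₁-rotate e₂ e₀ e₁))
        (ℓ₁-shift e₂<-1 (subst (-1ℤ ≤ℤ_) (sym (sum-rotate e₂ e₀ e₁)) (-1≤ΣΔ a b)))

open Distance

Φ : List Vertex → ℕ
Φ X = ∑∑ dist X X

record _≼_ (W′ W : FinSet) : Set where
  constructor _,_
  field
    size-≡     : ∣ W′ ∣ ≡ ∣ W ∣
    boundary-≤ : ∣𝒩 W′ ∣ ≤ ∣𝒩 W ∣

module RowsAbove where
  open import Data.Integer using (suc) renaming (_<_ to _<ℤ_)
  import Data.Integer.Properties as ℤ
  open import Data.Fin.Properties using (any?)
  open import Data.List.Membership.Propositional using (find; lose)
  import Data.List.Relation.Unary.Any as Any
  open import Relation.Nullary using (Dec)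
  open import Relation.Nullary.Decidable using (¬?; _×-dec_; map′)

  -- Bad rows lying just above a vertex of W can be searched for, and by topmost-below-BadAbove
  -- one exists as soon as any bad row does.
  BadAbove : FinSet → Direction → Vertex → Set
  BadAbove W i z = White W i (suc (coord i z)) × ∃ λ z₂ → z₂ ∈ elems W × suc (coord i z) <ℤ coord i z₂

  BadAbove⇒Bad : ∀ {W i z} → z ∈ elems W → BadAbove W i z → Bad W i (suc (coord i z))
  BadAbove⇒Bad {z = z} z∈ (white , z₂ , z₂∈ , <z₂) =
    white , _ , _ , ℤ.suc[i]≤j⇒i<j ℤ.≤-refl , <z₂ , (z , z∈ , refl) , (z₂ , z₂∈ , refl)

  ∃∈? : ∀ {P : Vertex → Set} → (∀ x → Dec (P x)) → ∀ xs → Dec (∃ λ x → x ∈ xs × P x)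
  ∃∈? P? xs = map′ find (λ (x , x∈ , px) → lose x∈ px) (Any.any? P? xs)

  BadAbove? : ∀ W i z → Dec (BadAbove W i z)
  BadAbove? W i z = ¬? (∃∈? (λ u → coord i u ℤ.≟ suc (coord i z)) (elems W))
              ×-dec ∃∈? (λ z₂ → suc (coord i z) ℤ.<? coord i z₂) (elems W)

  badAbove? : ∀ W → Dec (∃ λ i → ∃ λ z → z ∈ elems W × BadAbove W i z)
  badAbove? W = any? (λ i → ∃∈? (BadAbove? W i) (elems W))

open RowsAbove

module WhiteRow (W : FinSet) (i : Direction) (r : ℤ) (white : White W i r) where
  open import Data.Nat using (ℕ; _+_; _≤_; _<_)
  import Data.Nat.Properties as ℕ
  open import Data.Nat.Tactic.RingSolver using (solve-∀)
  open import Data.Integer using (-1ℤ)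
    renaming (suc to sucℤ; _+_ to _+ℤ_; _<_ to _<ℤ_; _≤_ to _≤ℤ_; _<?_ to _<ℤ?_)
  import Data.Integer.Properties as ℤ
  open import Data.List.Extrema ℤ.≤-totalOrder using (argmax; argmax-all; f[xs]≤f[argmax])
  import Data.List.Relation.Unary.All as All
  open import Data.List using (List; _++_; filter; length)
  open import Data.List.Properties using (length-++; length-map)
  open import Data.List.Membership.Propositional.Properties
    using (∈-filter⁺; ∈-filter⁻; ∈-++⁺ˡ; ∈-++⁺ʳ; ∈-++⁻)
  open import Data.List.Relation.Unary.Unique.Propositional.Properties as Unique using ()
  open import Function using (_∘_)
  open import Relation.Nullary using (Dec; yes; no)
  open import Relation.Nullary.Decidable using (¬?)

  isBelow? : ∀ u → Dec (coord i u <ℤ r)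
  isBelow? u = coord i u <ℤ? r

  below above : List Vertex
  below = filter isBelow? (elems W)
  above = filter (¬? ∘ isBelow?) (elems W)

  ∈-below⁻ : ∀ {u} → u ∈ below → u ∈ elems W × coord i u <ℤ r
  ∈-below⁻ = ∈-filter⁻ isBelow?

  ∈-above⁻ : ∀ {u} → u ∈ above → u ∈ elems W × r <ℤ coord i u
  ∈-above⁻ {u} u∈ with ∈-filter⁻ (¬? ∘ isBelow?) u∈
  ... | u∈W , u≮r = u∈W , ℤ.≤∧≢⇒< (ℤ.≮⇒≥ u≮r) (λ r≡u → white (u , u∈W , sym r≡u))

  ∈-below⁺ : ∀ {u} → u ∈ elems W → coord i u <ℤ r → u ∈ below
  ∈-below⁺ = ∈-filter⁺ isBelow?

  ∈-above⁺ : ∀ {u} → u ∈ elems W → r <ℤ coord i u → u ∈ above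
  ∈-above⁺ u∈W r<u = ∈-filter⁺ (¬? ∘ isBelow?) u∈W (ℤ.<-asym r<u)

  ∈W⇒below⊎above : ∀ {u} → u ∈ elems W → u ∈ below ⊎ u ∈ above
  ∈W⇒below⊎above {u} u∈W with isBelow? u
  ... | yes u<r = inj₁ (∈-below⁺ u∈W u<r)
  ... | no  u≮r = inj₂ (∈-filter⁺ (¬? ∘ isBelow?) u∈W u≮r)

  W-Splits : Splits (elems W) below above
  W-Splits = filter-Splits isBelow? (elems W)

  belowSet aboveSet : FinSet
  belowSet = below , Unique.filter⁺ isBelow? (proj₂ W)
  aboveSet = above , Unique.filter⁺ (¬? ∘ isBelow?) (proj₂ W)

  𝒩below⇒𝒩W : ∀ {x} → 𝒩 belowSet x → 𝒩 W x
  𝒩below⇒𝒩W {x} (x∉below , a , a∈below , adj) = x∉W , a , proj₁ (∈-below⁻ a∈below) , adj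
    where
    x∉W : ¬ x ∈ elems W
    x∉W x∈W with ∈W⇒below⊎above x∈W
    ... | inj₁ x∈below = x∉below x∈below
    ... | inj₂ x∈above = ℤ.<⇒≱ (proj₂ (∈-above⁻ x∈above)) (Adj-below i adj (proj₂ (∈-below⁻ a∈below)))

  𝒩above⇒𝒩W : ∀ {x} → 𝒩 aboveSet x → 𝒩 W x
  𝒩above⇒𝒩W {x} (x∉above , b , b∈above , adj) = x∉W , b , proj₁ (∈-above⁻ b∈above) , adj
    where
    x∉W : ¬ x ∈ elems W
    x∉W x∈W with ∈W⇒below⊎above x∈W
    ... | inj₁ x∈below = ℤ.<⇒≱ (proj₂ (∈-below⁻ x∈below)) (Adj-above i adj (proj₂ (∈-above⁻ b∈above)))
    ... | inj₂ x∈above = x∉above x∈above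

  ∣𝒩below∣+∣𝒩above∣≤∣𝒩W∣ : ∣𝒩 belowSet ∣ + ∣𝒩 aboveSet ∣ ≤ ∣𝒩 W ∣
  ∣𝒩below∣+∣𝒩above∣≤∣𝒩W∣ = subst (_≤ ∣𝒩 W ∣) (length-++ (neighbourhood belowSet))
    (Unique-⊆⇒length≤ (Unique.++⁺ (neighbourhood-unique belowSet) (neighbourhood-unique aboveSet) disjoint)
                      ⊆𝒩W)
    where
    disjoint : ∀ {x} → ¬ (x ∈ neighbourhood belowSet × x ∈ neighbourhood aboveSet)
    disjoint (x∈₁ , x∈₂) with ∈neighbourhood⇒𝒩 belowSet x∈₁ | ∈neighbourhood⇒𝒩 aboveSet x∈₂
    ... | _ , a , a∈ , adjᵃ | _ , b , b∈ , adjᵇ =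
      ¬Adj-straddle i adjᵃ adjᵇ (proj₂ (∈-below⁻ a∈)) (proj₂ (∈-above⁻ b∈))
    ⊆𝒩W : ∀ {x} → x ∈ neighbourhood belowSet ++ neighbourhood aboveSet → x ∈ neighbourhood W
    ⊆𝒩W x∈ with ∈-++⁻ (neighbourhood belowSet) x∈
    ... | inj₁ x∈₁ = 𝒩⇒∈neighbourhood W (𝒩below⇒𝒩W (∈neighbourhood⇒𝒩 belowSet x∈₁))
    ... | inj₂ x∈₂ = 𝒩⇒∈neighbourhood W (𝒩above⇒𝒩W (∈neighbourhood⇒𝒩 aboveSet x∈₂))

  acrossʳ acrossˡ : ℤ × ℤ → ℕ
  acrossʳ t = ∑∑ (λ a b → dist a (translate t b)) below above
  acrossˡ t = ∑∑ (λ b a → dist (translate t b) a) above below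

  module Shift (t : ℤ × ℤ) (offset≡-1 : offset i t ≡ -1ℤ) where

    shifted : List Vertex
    shifted = below ++ map (translate t) above

    r≤translated : ∀ {v} → v ∈ map (translate t) above → r ≤ℤ coord i v
    r≤translated v∈ with ∈-map⁻ (translate t) v∈
    ... | b , b∈above , refl =
      subst (r ≤ℤ_) (sym coord≡pred) (ℤ.i<j⇒i≤pred[j] (proj₂ (∈-above⁻ b∈above)))
      where
      coord≡pred = trans (coord-translate i t b)
                         (trans (cong (coord i b +ℤ_) offset≡-1) (ℤ.+-comm (coord i b) -1ℤ))

    shiftedSet : FinSet
    shiftedSet =
      shifted , Unique.++⁺ (proj₂ belowSet) (Unique.map⁺ (translate-injective t) (proj₂ aboveSet)) disjoint
      where
      disjoint : ∀ {v} → ¬ (v ∈ below × v ∈ map (translate t) above)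
      disjoint (v∈below , v∈translated) = ℤ.<⇒≱ (proj₂ (∈-below⁻ v∈below)) (r≤translated v∈translated)

    ∣shifted∣≡∣W∣ : ∣ shiftedSet ∣ ≡ ∣ W ∣
    ∣shifted∣≡∣W∣ = trans (length-++ below)
      (trans (cong (length below +_) (length-map (translate t) above)) (sym (Splits⇒length W-Splits)))

    𝒩shifted⊆ : ∀ {x} → 𝒩 shiftedSet x →
                x ∈ neighbourhood belowSet ++ map (translate t) (neighbourhood aboveSet)
    𝒩shifted⊆ {x} (x∉ , y , y∈ , adj) with ∈-++⁻ below y∈
    ... | inj₁ y∈below =
      ∈-++⁺ˡ (𝒩⇒∈neighbourhood belowSet ((λ x∈ → x∉ (∈-++⁺ˡ x∈)) , y , y∈below , adj))
    ... | inj₂ y∈translated with ∈-map⁻ (translate t) y∈translated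
    ...   | b , b∈above , refl =
      ∈-++⁺ʳ (neighbourhood belowSet) (subst (_∈ map (translate t) (neighbourhood aboveSet)) x′↦x
        (∈-map⁺ (translate t) (𝒩⇒∈neighbourhood aboveSet (x′∉above , b , b∈above , x′-adj))))
      where
      x′ = translate (negate t) x
      x′↦x = translate-negate⁻ t x
      x′-adj : Adj x′ b
      x′-adj = subst (Adj x′) (translate-negate t b) (translate-Adj (negate t) adj)
      x′∉above : ¬ x′ ∈ above
      x′∉above x′∈ = x∉ (∈-++⁺ʳ below (subst (_∈ map (translate t) above) x′↦x (∈-map⁺ (translate t) x′∈)))

    shiftedSet≼W : shiftedSet ≼ W
    shiftedSet≼W = ∣shifted∣≡∣W∣ , (begin
      ∣𝒩 shiftedSet ∣
        ≤⟨ ∣𝒩∣≤length shiftedSet 𝒩shifted⊆ ⟩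
      length (neighbourhood belowSet ++ map (translate t) (neighbourhood aboveSet))
        ≡⟨ length≡ ⟩
      ∣𝒩 belowSet ∣ + ∣𝒩 aboveSet ∣
        ≤⟨ ∣𝒩below∣+∣𝒩above∣≤∣𝒩W∣ ⟩
      ∣𝒩 W ∣ ∎)
      where
      open ℕ.≤-Reasoning
      length≡ = trans (length-++ (neighbourhood belowSet))
                      (cong (∣𝒩 belowSet ∣ +_) (length-map (translate t) (neighbourhood aboveSet)))

    Φ-shifted : Φ shifted ≡ (Φ below + Φ above) + (acrossʳ t + acrossˡ t)
    Φ-shifted = trans (∑∑-Splits (++-Splits below (map (translate t) above)) dist)
      (cong₂ _+_ (cong (Φ below +_) Φ-translated)
                 (cong₂ _+_ (∑∑-mapʳ (translate t) dist below above) (∑∑-mapˡ (translate t) dist above below)))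
      where
      Φ-translated : Φ (map (translate t) above) ≡ Φ above
      Φ-translated = trans (∑∑-mapˡ (translate t) dist above (map (translate t) above))
        (trans (∑∑-mapʳ (translate t) (dist ∘ translate t) above above) (∑∑-cong above above (dist-translate t)))

  module Shift₁ = Shift (shift₁ i) (offset-shift₁ i)
  module Shift₂ = Shift (shift₂ i) (offset-shift₂ i)

  acrossʳ-average : ∀ {a₀ b₀} → a₀ ∈ below → b₀ ∈ above →
                    acrossʳ (shift₁ i) + acrossʳ (shift₂ i) < ∑∑ dist below above + ∑∑ dist below above
  acrossʳ-average a₀∈ b₀∈ =
    subst₂ _<_ (∑∑-distrib-+ (λ a b → dist a (translate (shift₁ i) b)) (λ a b → dist a (translate (shift₂ i) b))
                             below above)
               (∑∑-distrib-+ dist dist below above)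
      (∑∑-mono-< (λ a∈ b∈ → dist-shift i (proj₂ (∈-below⁻ a∈)) (proj₂ (∈-above⁻ b∈))) a₀∈ b₀∈)

  acrossˡ-average : ∀ {a₀ b₀} → a₀ ∈ below → b₀ ∈ above →
                    acrossˡ (shift₁ i) + acrossˡ (shift₂ i) < ∑∑ dist above below + ∑∑ dist above below
  acrossˡ-average a₀∈ b₀∈ =
    subst₂ _<_ (∑∑-distrib-+ (λ b a → dist (translate (shift₁ i) b) a) (λ b a → dist (translate (shift₂ i) b) a)
                             above below)
               (∑∑-distrib-+ dist dist above below)
      (∑∑-mono-< (λ {b} {a} b∈ a∈ →
        subst₂ _<_ (cong₂ _+_ (dist-sym a (translate (shift₁ i) b)) (dist-sym a (translate (shift₂ i) b)))
                   (cong₂ _+_ (dist-sym a b) (dist-sym a b))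
          (dist-shift i (proj₂ (∈-below⁻ a∈)) (proj₂ (∈-above⁻ b∈)))) b₀∈ a₀∈)

  Φ-shifted-average : ∀ {a₀ b₀} → a₀ ∈ below → b₀ ∈ above →
                      Φ Shift₁.shifted + Φ Shift₂.shifted < Φ (elems W) + Φ (elems W)
  Φ-shifted-average a₀∈ b₀∈ =
    subst₂ _<_ (sym (cong₂ _+_ Shift₁.Φ-shifted Shift₂.Φ-shifted)) (sym (cong₂ _+_ Φ-W Φ-W))
      (averaging (Φ below + Φ above) (∑∑ dist below above) (∑∑ dist above below)
        (acrossʳ (shift₁ i)) (acrossʳ (shift₂ i)) (acrossˡ (shift₁ i)) (acrossˡ (shift₂ i))
        (acrossʳ-average a₀∈ b₀∈) (acrossˡ-average a₀∈ b₀∈))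
    where
    Φ-W = ∑∑-Splits W-Splits dist
    averaging : ∀ c x y x₁ x₂ y₁ y₂ → x₁ + x₂ < x + x → y₁ + y₂ < y + y →
                (c + (x₁ + y₁)) + (c + (x₂ + y₂)) < (c + (x + y)) + (c + (x + y))
    averaging c x y x₁ x₂ y₁ y₂ x< y< =
      subst₂ _<_ (lemma c x₁ x₂ y₁ y₂) (lemma c x x y y) (ℕ.+-monoʳ-< (c + c) (ℕ.+-mono-< x< y<))
      where lemma : ∀ c a b d e → (c + c) + ((a + b) + (d + e)) ≡ (c + (a + d)) + (c + (b + e))
            lemma = solve-∀

  closeWhiteRow : ∀ {z₁ z₂} → z₁ ∈ below → z₂ ∈ above →
                  Σ FinSet λ W′ → W′ ≼ W × Φ (elems W′) < Φ (elems W)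
  closeWhiteRow z₁∈ z₂∈ with x+y<z+z⇒x<z⊎y<z (Φ-shifted-average z₁∈ z₂∈)
  ... | inj₁ Φ₁< = Shift₁.shiftedSet , Shift₁.shiftedSet≼W , Φ₁<
  ... | inj₂ Φ₂< = Shift₂.shiftedSet , Shift₂.shiftedSet≼W , Φ₂<

  topmost-below-BadAbove : ∀ {z₁ z₂} → z₁ ∈ below → z₂ ∈ above → ∃ λ m → m ∈ elems W × BadAbove W i m
  topmost-below-BadAbove {z₁} {z₂} z₁∈ z₂∈ =
    m , proj₁ m-below , white-above-m , z₂ , proj₁ (∈-above⁻ z₂∈) , m+1<z₂
    where
    m = argmax (coord i) z₁ below
    m-below : m ∈ elems W × coord i m <ℤ r
    m-below = argmax-all (coord i) (∈-below⁻ z₁∈) (All.tabulate ∈-below⁻)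
    ≤m : ∀ {u} → u ∈ below → coord i u ≤ℤ coord i m
    ≤m = All.lookup (f[xs]≤f[argmax] z₁ below)
    m+1≤r : sucℤ (coord i m) ≤ℤ r
    m+1≤r = ℤ.i<j⇒suc[i]≤j (proj₂ m-below)
    white-above-m : White W i (sucℤ (coord i m))
    white-above-m (u , u∈W , u≡m+1) with ∈W⇒below⊎above u∈W
    ... | inj₁ u∈below = ℤ.<⇒≱ (subst (coord i m <ℤ_) (sym u≡m+1) (ℤ.suc[i]≤j⇒i<j ℤ.≤-refl)) (≤m u∈below)
    ... | inj₂ u∈above = ℤ.<⇒≱ (subst (r <ℤ_) u≡m+1 (proj₂ (∈-above⁻ u∈above))) m+1≤r
    m+1<z₂ : sucℤ (coord i m) <ℤ coord i z₂
    m+1<z₂ = ℤ.≤-<-trans m+1≤r (proj₂ (∈-above⁻ z₂∈))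

module Compression where
  open import Data.Nat.Induction using (<-wellFounded)
  import Data.Nat.Properties as ℕ
  open import Function using (_∘_; _on_)
  open import Induction.WellFounded using (Acc; acc)
  open import Relation.Binary.Construct.On using (wellFounded)
  open import Relation.Nullary using (yes; no)

  closeBadRow : ∀ {W i r} → Bad W i r → Σ FinSet λ W′ → W′ ≼ W × Φ (elems W′) < Φ (elems W)
  closeBadRow {W} {i} {r} (white , _ , _ , r₁<r , r<r₂ , (z₁ , z₁∈ , refl) , (z₂ , z₂∈ , refl)) =
    closeWhiteRow (∈-below⁺ z₁∈ r₁<r) (∈-above⁺ z₂∈ r<r₂)
    where open WhiteRow W i r white

  Bad⇒BadAbove : ∀ {W} i {r} → Bad W i r → ∃ λ z → z ∈ elems W × BadAbove W i z
  Bad⇒BadAbove {W} i {r} (white , _ , _ , r₁<r , r<r₂ , (z₁ , z₁∈ , refl) , (z₂ , z₂∈ , refl)) =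
    topmost-below-BadAbove (∈-below⁺ z₁∈ r₁<r) (∈-above⁺ z₂∈ r<r₂)
    where open WhiteRow W i r white

  badRow? : ∀ W → NoBadRow W ⊎ ∃ λ i → ∃ (Bad W i)
  badRow? W with badAbove? W
  ... | yes (i , z , z∈ , badAbove) = inj₂ (i , _ , BadAbove⇒Bad {W} {i} z∈ badAbove)
  ... | no  ¬badAbove               = inj₁ λ i r bad → ¬badAbove (i , Bad⇒BadAbove {W} i {r} bad)

  ≼-refl : ∀ {W} → W ≼ W
  ≼-refl = refl , ℕ.≤-refl

  ≼-trans : ∀ {U V W} → U ≼ V → V ≼ W → U ≼ W
  ≼-trans (∣U∣≡ , 𝒩U≤) (∣V∣≡ , 𝒩V≤) = trans ∣U∣≡ ∣V∣≡ , ℕ.≤-trans 𝒩U≤ 𝒩V≤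

  compress : ∀ W → Acc (_<_ on (Φ ∘ elems)) W → Σ FinSet λ W′ → W′ ≼ W × NoBadRow W′
  compress W (acc smaller) with badRow? W
  ... | inj₁ noBadRow = W , ≼-refl , noBadRow
  ... | inj₂ (i , r , bad) with closeBadRow {W} {i} {r} bad
  ...   | W₁ , W₁≼W , Φ< with compress W₁ (smaller Φ<)
  ...     | W′ , W′≼W₁ , noBadRow = W′ , ≼-trans W′≼W₁ W₁≼W , noBadRow

  noBadRow-compression : ∀ W → Σ FinSet λ W′ → W′ ≼ W × NoBadRow W′
  noBadRow-compression W = compress W (wellFounded (Φ ∘ elems) <-wellFounded W)

open Compression

lemma2 : (W : FinSet) → Σ FinSet λ W' →
    ∣ W' ∣ ≡ ∣ W ∣ ×
    (∃ λ n → ∃ λ n' → HasCard (𝒩 W) n × HasCard (𝒩 W') n' × n' ≤ n) ×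
    NoBadRow W'
lemma2 W with noBadRow-compression W
... | W′ , (∣W′∣≡∣W∣ , ∣𝒩W′∣≤∣𝒩W∣) , noBadRow =
  W′ , ∣W′∣≡∣W∣ , (∣𝒩 W ∣ , ∣𝒩 W′ ∣ , 𝒩-hasCard W , 𝒩-hasCard W′ , ∣𝒩W′∣≤∣𝒩W∣) , noBadRow
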